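{- For any $r_1, r_2, s \in \mathbb N$, we have $C(r_1 + r_2 + 1, s) \ge C(r_1, s) + C(r_2, s)$. Similarly, for any $r, s_1, s_2 \in \mathbb N$, we have $C(r, s_1 + s_2 + 1) \ge C(r, s_1) + C(r, s_2)$.
   Context: A permutation of length $n\ge 0$ is a bijection $\pi$ of $[n]=\{1,\dots,n\}$, written as the sequence $\pi(1)\ldots\pi(n)$. A permutation $\pi$ contains $\tau$ (i.e. $\tau$ is a pattern of $\pi$) if $\pi$ has a subsequence whose terms are in the same relative order as $\tau$; the pattern is proper if it comes from a proper subsequence (i.e. $\tau$ is shorter than $\pi$). $\mathbb N=\{0,1,2,\dots\}$. For $r,s\in\mathbb N$, $\pi$ is $(r,s)$-coverable if its terms can be partitioned into $r$ increasing and $s$ decreasing (possibly empty) subsequences. $\pi$ is $(r,s)$-critical if $\pi$ is not $(r,s)$-coverable but every proper pattern of $\pi$ is $(r,s)$-coverable. $C(r,s)$ denotes the supremum (in $\mathbb N\cup\{\infty\}$) of the lengths of $(r,s)$-critical permutations. -}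

module Defs where

open import Data.Nat using (ℕ; _<_; _≤_; _+_)
open import Data.Fin using (Fin) renaming (_<_ to _<ᶠ_)
open import Data.Sum using (_⊎_; inj₁; inj₂)
open import Data.Product using (Σ; _×_; _,_; ∃)
open import Relation.Nullary using (¬_)
open import Relation.Binary.PropositionalEquality using (_≡_)
open import Function.Definitions using (Injective)
open import Function.Bundles using (_⇔_)

-- A permutation of length n: a bijection of [n] (here Fin n); an injective
-- self-map of a finite set is a bijection.  π i is the (i+1)-th term.
record Perm (n : ℕ) : Set where
  constructor perm
  field
    fun : Fin n → Fin n
    inj : Injective _≡_ _≡_ fun
open Perm public

Contains : ∀ {n k} → Perm n → Perm k → Set
Contains {n} {k} π τ =
  Σ (Fin k → Fin n) λ f →
    (∀ i j → i <ᶠ j → f i <ᶠ f j) ×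
    (∀ i j → (fun τ i <ᶠ fun τ j) ⇔ (fun π (f i) <ᶠ fun π (f j)))

-- (r,s)-coverable: the positions can be coloured by r "increasing" colours and
-- s "decreasing" colours (each colour class = one possibly empty subsequence)
-- so that each increasing class is increasing and each decreasing class is decreasing.
Coverable : ℕ → ℕ → ∀ {n} → Perm n → Set
Coverable r s {n} π =
  Σ (Fin n → Fin r ⊎ Fin s) λ c →
    (∀ i j a → c i ≡ inj₁ a → c j ≡ inj₁ a → i <ᶠ j → fun π i <ᶠ fun π j) ×
    (∀ i j b → c i ≡ inj₂ b → c j ≡ inj₂ b → i <ᶠ j → fun π j <ᶠ fun π i)

Critical : ℕ → ℕ → ∀ {n} → Perm n → Set
Critical r s {n} π =
  ¬ Coverable r s π ×
  (∀ k (τ : Perm k) → k < n → Contains π τ → Coverable r s τ)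

-- "m ≤ C(r,s)" where C(r,s) = sup (in ℕ ∪ {∞}) of lengths of (r,s)-critical
-- permutations (with sup ∅ = 0): either m = 0 or some (r,s)-critical
-- permutation has length ≥ m.
LeC : ℕ → ℕ → ℕ → Set
LeC m r s = m ≡ 0 ⊎ Σ ℕ λ n → Σ (Perm n) λ π → Critical r s π × m ≤ n

-- No decreasing subsequence of a direct sum π ⊕ σ meets both summands. So in a cover of π ⊕ σ by
-- r increasing and s₁ + s₂ + 1 decreasing sequences, the decreasing colours used on π and on σ are
-- disjoint, and one side uses at most s₁, resp. s₂, of them: if π is (r, s₁)-critical and σ is
-- (r, s₂)-critical, π ⊕ σ is not (r, s₁ + s₂ + 1)-coverable. A proper pattern of π ⊕ σ misses a point,
-- say a in π; pick any b in σ. By criticality π - a and σ - b are (r, s₁)- and (r, s₂)-coverable, and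
-- adding {a, b} as one more decreasing class covers the pattern, which contains at most one of a, b.
-- Complementing values swaps increasing and decreasing and turns ⊕ into the skew sum ⊖.
module Submission where

open import Defs
open import Data.Nat using (ℕ; _+_)
open import Data.Product using (_×_)

open import Data.Empty using (⊥; ⊥-elim)
open import Data.Fin using (Fin; zero; suc; _<_; _↑ˡ_; _↑ʳ_; splitAt; join; punchIn; punchOut; opposite; inject≤; toℕ; _≟_)
import Data.Fin.Properties as Fin
open import Data.Maybe as Maybe using (Maybe; just; nothing; maybe)
import Data.Maybe.Properties as Maybe
open import Data.Nat as ℕ using (zero; suc; _≤_; _≤?_; z≤n; s≤s)
import Data.Nat.Properties as ℕₚ
open import Data.Product using (Σ; ∃; _,_; proj₁; proj₂)
open import Data.Sum as Sum using (_⊎_; inj₁; inj₂; [_,_]′; swap)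
open import Data.Sum.Properties using (inj₁-injective; inj₂-injective; swap-involutive; ≡-dec)
open import Data.Unit using (⊤; tt)
open import Function using (_∘_; id)
open import Function.Bundles using (_⇔_; mk⇔; Equivalence)
import Function.Properties.Equivalence as ⇔
open import Function.Definitions using (Injective)
open import Relation.Binary.PropositionalEquality
open import Relation.Nullary using (¬_; yes; no)
open import Relation.Unary using (Decidable)

private variable
  n m k r s s₁ s₂ : ℕ
  I I′ D D′ : Set

Step : I ⊎ D → Fin n → Fin n → Set
Step (inj₁ _) x y = x < y
Step (inj₂ _) x y = y < x

record ValidOn (U : Fin n → Set) (π : Perm n) (c : Fin n → I ⊎ D) : Set where
  constructor validOn
  field
    steps : ∀ {i j} → U i → U j → i < j → c i ≡ c j → Step (c i) (fun π i) (fun π j)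
open ValidOn public

Valid : Perm n → (Fin n → I ⊎ D) → Set
Valid = ValidOn (λ _ → ⊤)

valid⇒coverable : {π : Perm n} {c : Fin n → Fin r ⊎ Fin s} → Valid π c → Coverable r s π
valid⇒coverable {π = π} {c} valid = c , (λ i j a → step (inj₁ a)) , (λ i j b → step (inj₂ b))
  where
  step : ∀ {i j} u → c i ≡ u → c j ≡ u → i < j → Step u (fun π i) (fun π j)
  step u ci≡u cj≡u i<j = subst (λ v → Step v _ _) ci≡u (steps valid tt tt i<j (trans ci≡u (sym cj≡u)))

coverable⇒valid : {π : Perm n} (cover : Coverable r s π) → Valid π (proj₁ cover)
coverable⇒valid {π = π} (c , increasing , decreasing) = validOn λ {i} _ _ → step (c i) refl
  where
  step : ∀ {i j} u → c i ≡ u → i < j → c i ≡ c j → Step u (fun π i) (fun π j)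
  step (inj₁ a) ci≡u i<j ci≡cj = increasing _ _ a ci≡u (trans (sym ci≡cj) ci≡u) i<j
  step (inj₂ b) ci≡u i<j ci≡cj = decreasing _ _ b ci≡u (trans (sym ci≡cj) ci≡u) i<j

Step-⇔ : {x y : Fin n} {x′ y′ : Fin m} (u : I ⊎ D) →
         (x < y ⇔ x′ < y′) → (y < x ⇔ y′ < x′) → Step u x y ⇔ Step u x′ y′
Step-⇔ (inj₁ _) up down = up
Step-⇔ (inj₂ _) up down = down

Step-map : {x y : Fin n} (f : I → I′) (g : D → D′) (u : I ⊎ D) → Step u x y → Step (Sum.map f g u) x y
Step-map f g (inj₁ _) step = step
Step-map f g (inj₂ _) step = step

Sum-map-injective : {f : I → I′} {g : D → D′} →
                    Injective _≡_ _≡_ f → Injective _≡_ _≡_ g → Injective _≡_ _≡_ (Sum.map f g)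
Sum-map-injective f-inj g-inj {inj₁ _} {inj₁ _} e = cong inj₁ (f-inj (inj₁-injective e))
Sum-map-injective f-inj g-inj {inj₂ _} {inj₂ _} e = cong inj₂ (g-inj (inj₂-injective e))
Sum-map-injective f-inj g-inj {inj₁ _} {inj₂ _} ()
Sum-map-injective f-inj g-inj {inj₂ _} {inj₁ _} ()

validOn-contains : ∀ {U} {π : Perm n} {τ : Perm k} {c : Fin n → I ⊎ D} (τ⊆π : Contains π τ) →
                   (∀ i → U (proj₁ τ⊆π i)) → ValidOn U π c → Valid τ (c ∘ proj₁ τ⊆π)
validOn-contains {c = c} (f , f-mono , f-iso) f∈U valid = validOn λ {i} {j} _ _ i<j ci≡cj →
  Equivalence.from (Step-⇔ (c (f i)) (f-iso i j) (f-iso j i))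
                   (steps valid (f∈U i) (f∈U j) (f-mono i j i<j) ci≡cj)

valid-contains : {π : Perm n} {τ : Perm k} {c : Fin n → I ⊎ D} (τ⊆π : Contains π τ) →
                 Valid π c → Valid τ (c ∘ proj₁ τ⊆π)
valid-contains τ⊆π = validOn-contains τ⊆π (λ _ → tt)

validOn-map : ∀ {U} {π : Perm n} {c : Fin n → I ⊎ D} {f : I → I′} {g : D → D′} →
              Injective _≡_ _≡_ f → Injective _≡_ _≡_ g → ValidOn U π c → ValidOn U π (Sum.map f g ∘ c)
validOn-map {c = c} {f} {g} f-inj g-inj valid = validOn λ {i} ui uj i<j ci≡cj →
  Step-map f g (c i) (steps valid ui uj i<j (Sum-map-injective f-inj g-inj ci≡cj))

validOn-cong : ∀ {U} {π : Perm n} {c c′ : Fin n → I ⊎ D} → c ≗ c′ → ValidOn U π c → ValidOn U π c′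
validOn-cong c≗c′ valid = validOn λ {i} {j} ui uj i<j c′i≡c′j →
  subst (λ u → Step u _ _) (c≗c′ i) (steps valid ui uj i<j (trans (c≗c′ i) (trans c′i≡c′j (sym (c≗c′ j)))))

coverable-mono : {π : Perm n} {s′ : ℕ} → s ≤ s′ → Coverable r s π → Coverable r s′ π
coverable-mono {r = r} {π = π} s≤s′ cover =
  valid⇒coverable (validOn-map {f = id {A = Fin r}} {g = λ b → inject≤ b s≤s′}
                               id (Fin.inject≤-injective s≤s′ s≤s′ _ _) (coverable⇒valid {π = π} cover))

recolour : (u : I ⊎ D) → (∀ {x} → u ≡ inj₂ x → D′) → I ⊎ D′
recolour (inj₁ a) h = inj₁ a
recolour (inj₂ x) h = inj₂ (h refl)

recolour-injective : (u v : I ⊎ D) {h : ∀ {x} → u ≡ inj₂ x → D′} {h′ : ∀ {y} → v ≡ inj₂ y → D′} →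
                     (∀ {x y} (e : u ≡ inj₂ x) (e′ : v ≡ inj₂ y) → h e ≡ h′ e′ → x ≡ y) →
                     recolour u h ≡ recolour v h′ → u ≡ v
recolour-injective (inj₁ a) (inj₁ b) h-inj e = cong inj₁ (inj₁-injective e)
recolour-injective (inj₂ x) (inj₂ y) h-inj e = cong inj₂ (h-inj refl refl (inj₂-injective e))
recolour-injective (inj₁ _) (inj₂ _) h-inj ()
recolour-injective (inj₂ _) (inj₁ _) h-inj ()

Step-recolour : {x y : Fin n} (u : I ⊎ D) {h : ∀ {z} → u ≡ inj₂ z → D′} → Step u x y → Step (recolour u h) x y
Step-recolour (inj₁ _) step = step
Step-recolour (inj₂ _) step = step

valid-compress : {π : Perm n} {c : Fin n → I ⊎ D} (h : ∀ {i x} → c i ≡ inj₂ x → D′) →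
                 (∀ {i j x y} (e : c i ≡ inj₂ x) (e′ : c j ≡ inj₂ y) → h e ≡ h e′ → x ≡ y) →
                 Valid π c → Σ (Fin n → I ⊎ D′) (Valid π)
valid-compress {c = c} h h-inj valid =
  (λ i → recolour (c i) (h {i})) ,
  validOn λ {i} {j} _ _ i<j e → Step-recolour (c i) (steps valid tt tt i<j (recolour-injective (c i) (c j) h-inj e))

record Split {S : ℕ} (A : Fin S → Set) : Set where
  field
    inside outside : ℕ
    inside+outside≡S : inside + outside ≡ S
    index : Fin S → Fin inside ⊎ Fin outside
    index-injective : Injective _≡_ _≡_ index
    index-inside : ∀ {x} → A x → ∃ λ y → index x ≡ inj₁ y
    index-outside : ∀ {x} → ¬ A x → ∃ λ y → index x ≡ inj₂ y

  inside-index : ∀ {x} → A x → Fin inside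
  inside-index = proj₁ ∘ index-inside

  inside-index-injective : ∀ {x y} (a : A x) (b : A y) → inside-index a ≡ inside-index b → x ≡ y
  inside-index-injective a b e =
    index-injective (trans (proj₂ (index-inside a)) (trans (cong inj₁ e) (sym (proj₂ (index-inside b)))))

  outside-index : ∀ {x} → ¬ A x → Fin outside
  outside-index = proj₁ ∘ index-outside

  outside-index-injective : ∀ {x y} (a : ¬ A x) (b : ¬ A y) → outside-index a ≡ outside-index b → x ≡ y
  outside-index-injective a b e =
    index-injective (trans (proj₂ (index-outside a)) (trans (cong inj₂ e) (sym (proj₂ (index-outside b)))))

module _ {S : ℕ} {A : Fin (suc S) → Set} (split : Split (A ∘ suc)) where
  open Split split

  split-inside-zero : A zero → Split A
  split-inside-zero a₀ = record
    { inside = suc inside ; outside = outside ; inside+outside≡S = cong suc inside+outside≡S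
    ; index = index′ ; index-injective = index′-injective
    ; index-inside = index′-inside ; index-outside = index′-outside }
    where
    index′ : Fin (suc S) → Fin (suc inside) ⊎ Fin outside
    index′ zero = inj₁ zero
    index′ (suc x) = Sum.map suc id (index x)

    suc-index≢zero : ∀ x → Sum.map suc id (index x) ≢ inj₁ zero
    suc-index≢zero x e with index x
    suc-index≢zero x () | inj₁ _
    suc-index≢zero x () | inj₂ _

    index′-injective : Injective _≡_ _≡_ index′
    index′-injective {zero} {zero} _ = refl
    index′-injective {zero} {suc y} e = ⊥-elim (suc-index≢zero y (sym e))
    index′-injective {suc x} {zero} e = ⊥-elim (suc-index≢zero x e)
    index′-injective {suc x} {suc y} e = cong suc (index-injective (Sum-map-injective Fin.suc-injective id e))

    index′-inside : ∀ {x} → A x → ∃ λ y → index′ x ≡ inj₁ y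
    index′-inside {zero} _ = zero , refl
    index′-inside {suc x} a = suc (proj₁ (index-inside a)) , cong (Sum.map suc id) (proj₂ (index-inside a))

    index′-outside : ∀ {x} → ¬ A x → ∃ λ y → index′ x ≡ inj₂ y
    index′-outside {zero} ¬a₀ = ⊥-elim (¬a₀ a₀)
    index′-outside {suc x} ¬a = proj₁ (index-outside ¬a) , cong (Sum.map suc id) (proj₂ (index-outside ¬a))

  split-outside-zero : ¬ A zero → Split A
  split-outside-zero ¬a₀ = record
    { inside = inside ; outside = suc outside
    ; inside+outside≡S = trans (ℕₚ.+-suc inside outside) (cong suc inside+outside≡S)
    ; index = index′ ; index-injective = index′-injective
    ; index-inside = index′-inside ; index-outside = index′-outside }
    where
    index′ : Fin (suc S) → Fin inside ⊎ Fin (suc outside)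
    index′ zero = inj₂ zero
    index′ (suc x) = Sum.map id suc (index x)

    suc-index≢zero : ∀ x → Sum.map id suc (index x) ≢ inj₂ zero
    suc-index≢zero x e with index x
    suc-index≢zero x () | inj₁ _
    suc-index≢zero x () | inj₂ _

    index′-injective : Injective _≡_ _≡_ index′
    index′-injective {zero} {zero} _ = refl
    index′-injective {zero} {suc y} e = ⊥-elim (suc-index≢zero y (sym e))
    index′-injective {suc x} {zero} e = ⊥-elim (suc-index≢zero x e)
    index′-injective {suc x} {suc y} e = cong suc (index-injective (Sum-map-injective id Fin.suc-injective e))

    index′-inside : ∀ {x} → A x → ∃ λ y → index′ x ≡ inj₁ y
    index′-inside {zero} a₀ = ⊥-elim (¬a₀ a₀)
    index′-inside {suc x} a = proj₁ (index-inside a) , cong (Sum.map id suc) (proj₂ (index-inside a))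

    index′-outside : ∀ {x} → ¬ A x → ∃ λ y → index′ x ≡ inj₂ y
    index′-outside {zero} _ = zero , refl
    index′-outside {suc x} ¬a = suc (proj₁ (index-outside ¬a)) , cong (Sum.map id suc) (proj₂ (index-outside ¬a))

split : {S : ℕ} (A : Fin S → Set) → Decidable A → Split A
split {zero} A A? = record
  { inside = 0 ; outside = 0 ; inside+outside≡S = refl
  ; index = λ () ; index-injective = λ { {()} } ; index-inside = λ { {()} } ; index-outside = λ { {()} } }
split {suc S} A A? with A? zero
... | yes a₀ = split-inside-zero (split (A ∘ suc) (A? ∘ suc)) a₀
... | no ¬a₀ = split-outside-zero (split (A ∘ suc) (A? ∘ suc)) ¬a₀

p+q≡a+b+1⇒p≤a⊎q≤b : ∀ {p q} a b → p + q ≡ a + b + 1 → p ≤ a ⊎ q ≤ b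
p+q≡a+b+1⇒p≤a⊎q≤b {p} {q} a b p+q≡ with p ≤? a
... | yes p≤a = inj₁ p≤a
... | no p≰a = inj₂ (ℕₚ.+-cancelˡ-≤ a q b (ℕ.s≤s⁻¹ (begin
  suc (a + q) ≤⟨ ℕₚ.+-monoˡ-≤ q (ℕₚ.≰⇒> p≰a) ⟩
  p + q       ≡⟨ p+q≡ ⟩
  a + b + 1   ≡⟨ ℕₚ.+-comm (a + b) 1 ⟩
  suc (a + b) ∎)))
  where open ℕₚ.≤-Reasoning

-- Direct sums

join-injective : ∀ n m → Injective _≡_ _≡_ (join n m)
join-injective n m {x} {y} e = trans (sym (Fin.splitAt-join n m x)) (trans (cong (splitAt n) e) (Fin.splitAt-join n m y))

splitAt-injective : ∀ n m → Injective _≡_ _≡_ (splitAt n {m})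
splitAt-injective n m {x} {y} e = trans (sym (Fin.join-splitAt n m x)) (trans (cong (join n m) e) (Fin.join-splitAt n m y))

_⊕_ : Perm n → Perm m → Perm (n + m)
_⊕_ {n} {m} π σ = perm (join n m ∘ Sum.map (fun π) (fun σ) ∘ splitAt n)
  (splitAt-injective n m ∘ Sum-map-injective (inj π) (inj σ) ∘ join-injective n m)

data ⊕-View (n m : ℕ) : Fin (n + m) → Set where
  left : (i : Fin n) → ⊕-View n m (i ↑ˡ m)
  right : (j : Fin m) → ⊕-View n m (n ↑ʳ j)

⊕-view : ∀ n {m} (k : Fin (n + m)) → ⊕-View n m k
⊕-view n k with splitAt n k in e
... | inj₁ i = subst (⊕-View n _) (Fin.splitAt⁻¹-↑ˡ e) (left i)
... | inj₂ j = subst (⊕-View n _) (Fin.splitAt⁻¹-↑ʳ e) (right j)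

↑ˡ-<-⇔ : ∀ {i j : Fin n} → i < j ⇔ i ↑ˡ m < j ↑ˡ m
↑ˡ-<-⇔ {m = m} {i} {j} = mk⇔ (subst₂ ℕ._<_ (sym (Fin.toℕ-↑ˡ i m)) (sym (Fin.toℕ-↑ˡ j m)))
                             (subst₂ ℕ._<_ (Fin.toℕ-↑ˡ i m) (Fin.toℕ-↑ˡ j m))

↑ʳ-<-⇔ : ∀ {i j : Fin m} → i < j ⇔ n ↑ʳ i < n ↑ʳ j
↑ʳ-<-⇔ {n = n} {i} {j} = mk⇔ (subst₂ ℕ._<_ (sym (Fin.toℕ-↑ʳ n i)) (sym (Fin.toℕ-↑ʳ n j)) ∘ ℕₚ.+-monoʳ-< n)
                             (ℕₚ.+-cancelˡ-< n _ _ ∘ subst₂ ℕ._<_ (Fin.toℕ-↑ʳ n i) (Fin.toℕ-↑ʳ n j))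

↑ˡ<↑ʳ : (i : Fin n) (j : Fin m) → i ↑ˡ m < n ↑ʳ j
↑ˡ<↑ʳ {n} {m} i j = subst₂ ℕ._<_ (sym (Fin.toℕ-↑ˡ i m)) (sym (Fin.toℕ-↑ʳ n j))
                                 (ℕₚ.<-≤-trans (Fin.toℕ<n i) (ℕₚ.m≤m+n n _))

module _ {π : Perm n} {σ : Perm m} where

  ⊕-ˡ : ∀ i → fun (π ⊕ σ) (i ↑ˡ m) ≡ fun π i ↑ˡ m
  ⊕-ˡ i = cong (join n m ∘ Sum.map (fun π) (fun σ)) (Fin.splitAt-↑ˡ n i m)

  ⊕-ʳ : ∀ j → fun (π ⊕ σ) (n ↑ʳ j) ≡ n ↑ʳ fun σ j
  ⊕-ʳ j = cong (join n m ∘ Sum.map (fun π) (fun σ)) (Fin.splitAt-↑ʳ n m j)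

  ⊕-containsˡ : Contains (π ⊕ σ) π
  ⊕-containsˡ = (_↑ˡ m) , (λ i j → Equivalence.to ↑ˡ-<-⇔) ,
    λ i j → subst₂ (λ x y → fun π i < fun π j ⇔ x < y) (sym (⊕-ˡ i)) (sym (⊕-ˡ j)) ↑ˡ-<-⇔

  ⊕-containsʳ : Contains (π ⊕ σ) σ
  ⊕-containsʳ = (n ↑ʳ_) , (λ i j → Equivalence.to ↑ʳ-<-⇔) ,
    λ i j → subst₂ (λ x y → fun σ i < fun σ j ⇔ x < y) (sym (⊕-ʳ i)) (sym (⊕-ʳ j)) ↑ʳ-<-⇔

  ⊕-across : ∀ i j → fun (π ⊕ σ) (i ↑ˡ m) < fun (π ⊕ σ) (n ↑ʳ j)
  ⊕-across i j = subst₂ _<_ (sym (⊕-ˡ i)) (sym (⊕-ʳ j)) (↑ˡ<↑ʳ (fun π i) (fun σ j))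

  ⊕-validOn : ∀ {U} {c : Fin (n + m) → I ⊎ D} →
              Valid π (c ∘ (_↑ˡ m)) → Valid σ (c ∘ (n ↑ʳ_)) →
              (∀ {i j x} → U (i ↑ˡ m) → U (n ↑ʳ j) → c (i ↑ˡ m) ≡ inj₂ x → c (n ↑ʳ j) ≡ inj₂ x → ⊥) →
              ValidOn U (π ⊕ σ) c
  ⊕-validOn {U = U} {c = c} validˡ validʳ crossing =
    validOn λ uk ul → step uk ul (⊕-view n _) (⊕-view n _)
    where
    step : ∀ {k l} → U k → U l → ⊕-View n m k → ⊕-View n m l → k < l → c k ≡ c l →
           Step (c k) (fun (π ⊕ σ) k) (fun (π ⊕ σ) l)
    step {k} _ _ (left i) (left j) k<l ck≡cl =
      Equivalence.to (Step-⇔ (c k) (iso i j) (iso j i)) (steps validˡ tt tt (Equivalence.from ↑ˡ-<-⇔ k<l) ck≡cl)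
      where iso = proj₂ (proj₂ ⊕-containsˡ)
    step {k} _ _ (right i) (right j) k<l ck≡cl =
      Equivalence.to (Step-⇔ (c k) (iso i j) (iso j i)) (steps validʳ tt tt (Equivalence.from ↑ʳ-<-⇔ k<l) ck≡cl)
      where iso = proj₂ (proj₂ ⊕-containsʳ)
    step _ _ (right i) (left j) k<l _ = ⊥-elim (ℕₚ.<-asym k<l (↑ˡ<↑ʳ j i))
    step {k} uk ul (left i) (right j) _ ck≡cl = across (c k) refl
      where
      across : ∀ u → c k ≡ u → Step u (fun (π ⊕ σ) k) (fun (π ⊕ σ) (n ↑ʳ j))
      across (inj₁ _) _ = ⊕-across i j
      across (inj₂ x) ck≡x = ⊥-elim (crossing uk ul ck≡x (trans (sym ck≡cl) ck≡x))

  ⊕-decreasing-disjoint : {c : Fin (n + m) → I ⊎ D} → Valid (π ⊕ σ) c →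
                          ∀ {i j x} → c (i ↑ˡ m) ≡ inj₂ x → c (n ↑ʳ j) ≡ inj₂ x → ⊥
  ⊕-decreasing-disjoint valid {i} {j} ci≡x cj≡x =
    ℕₚ.<-asym (⊕-across i j) (subst (λ u → Step u _ _) ci≡x (steps valid tt tt (↑ˡ<↑ʳ i j) (trans ci≡x (sym cj≡x))))

  ⊕-uncoverable : ¬ Coverable r s₁ π → ¬ Coverable r s₂ σ → ¬ Coverable r (s₁ + s₂ + 1) (π ⊕ σ)
  ⊕-uncoverable {r = r} {s₁ = s₁} {s₂ = s₂} π-uncoverable σ-uncoverable cover =
    Sum.[ (λ ≤s₁ → π-uncoverable (coverable-mono {π = π} ≤s₁ coverˡ))
        , (λ ≤s₂ → σ-uncoverable (coverable-mono {π = σ} ≤s₂ coverʳ)) ]′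
        (p+q≡a+b+1⇒p≤a⊎q≤b s₁ s₂ inside+outside≡S)
    where
    c = proj₁ cover
    valid : Valid (π ⊕ σ) c
    valid = coverable⇒valid cover

    UsedOnLeft : Fin (s₁ + s₂ + 1) → Set
    UsedOnLeft x = ∃ λ i → c (i ↑ˡ m) ≡ inj₂ x

    open Split (split UsedOnLeft (λ x → Fin.any? (λ i → ≡-dec _≟_ _≟_ (c (i ↑ˡ m)) (inj₂ x))))

    coverˡ : Coverable r inside π
    coverˡ = valid⇒coverable {π = π}
      (proj₂ (valid-compress (λ {i} e → inside-index (i , e)) (λ e e′ → inside-index-injective (_ , e) (_ , e′))
                             (valid-contains ⊕-containsˡ valid)))

    unused : ∀ {j x} → c (n ↑ʳ j) ≡ inj₂ x → ¬ UsedOnLeft x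
    unused cj≡x (i , ci≡x) = ⊕-decreasing-disjoint valid ci≡x cj≡x

    coverʳ : Coverable r outside σ
    coverʳ = valid⇒coverable {π = σ}
      (proj₂ (valid-compress (λ e → outside-index (unused e)) (λ e e′ → outside-index-injective (unused e) (unused e′))
                             (valid-contains ⊕-containsʳ valid)))

punchIn-mono-< : ∀ (a : Fin (suc n)) {i j} → i < j → punchIn a i < punchIn a j
punchIn-mono-< a {i} {j} i<j =
  Fin.≤∧≢⇒< (Fin.punchIn-mono-≤ a i j (ℕₚ.<⇒≤ i<j)) (ℕₚ.<⇒≢ i<j ∘ cong toℕ ∘ Fin.punchIn-injective a i j)

punchOut-<-⇔ : ∀ {a i j : Fin (suc n)} (a≢i : a ≢ i) (a≢j : a ≢ j) → i < j ⇔ punchOut a≢i < punchOut a≢j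
punchOut-<-⇔ {i = i} {j} a≢i a≢j = mk⇔ mono reflect
  where
  mono : i < j → punchOut a≢i < punchOut a≢j
  mono i<j = Fin.≤∧≢⇒< (Fin.punchOut-mono-≤ a≢i a≢j (ℕₚ.<⇒≤ i<j))
                       (ℕₚ.<⇒≢ i<j ∘ cong toℕ ∘ Fin.punchOut-injective a≢i a≢j)
  reflect : punchOut a≢i < punchOut a≢j → i < j
  reflect lt with i Fin.<? j
  ... | yes i<j = i<j
  ... | no i≮j = ⊥-elim (ℕₚ.<⇒≱ lt (Fin.punchOut-mono-≤ a≢j a≢i (ℕₚ.≮⇒≥ i≮j)))

fun-punchIn≢ : (π : Perm (suc n)) (a : Fin (suc n)) (i : Fin n) → fun π a ≢ fun π (punchIn a i)
fun-punchIn≢ π a i = Fin.punchInᵢ≢i a i ∘ sym ∘ inj π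

delete : Perm (suc n) → Fin (suc n) → Perm n
delete π a = perm (λ i → punchOut (fun-punchIn≢ π a i))
  λ {i} {j} e → Fin.punchIn-injective a i j
                  (inj π (Fin.punchOut-injective (fun-punchIn≢ π a i) (fun-punchIn≢ π a j) e))

delete-contained : (π : Perm (suc n)) (a : Fin (suc n)) → Contains π (delete π a)
delete-contained π a = punchIn a , (λ i j → punchIn-mono-< a) ,
  λ i j → ⇔.sym (punchOut-<-⇔ (fun-punchIn≢ π a i) (fun-punchIn≢ π a j))

-- Critical direct sums

map-just≢nothing : (u : I ⊎ D) → Sum.map id just u ≢ inj₂ nothing
map-just≢nothing (inj₁ _) ()
map-just≢nothing (inj₂ _) ()

-- π minus a is a proper pattern; a alone gets the new decreasing colour nothing.
critical-point : {π : Perm n} → Critical r s π → (a : Fin n) →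
                 Σ (Fin n → Fin r ⊎ Maybe (Fin s)) λ c → Valid π c × (∀ {i} → c i ≡ inj₂ nothing → i ≡ a)
critical-point {n = suc n} {r = r} {s = s} {π = π} (_ , patterns-coverable) a = c , validOn step , only-a
  where
  cover : Coverable r s (delete π a)
  cover = patterns-coverable n (delete π a) (ℕₚ.n<1+n n) (delete-contained π a)

  e : Fin n → Fin r ⊎ Fin s
  e = proj₁ cover

  e-valid : Valid (delete π a) e
  e-valid = coverable⇒valid {π = delete π a} cover

  c : Fin (suc n) → Fin r ⊎ Maybe (Fin s)
  c i with a ≟ i
  ... | yes _ = inj₂ nothing
  ... | no a≢i = Sum.map id just (e (punchOut a≢i))

  step : ∀ {i j} → ⊤ → ⊤ → i < j → c i ≡ c j → Step (c i) (fun π i) (fun π j)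
  step {i} {j} _ _ i<j ci≡cj with a ≟ i | a ≟ j
  ... | yes refl | yes refl = ⊥-elim (ℕₚ.<-irrefl refl i<j)
  ... | yes _ | no a≢j = ⊥-elim (map-just≢nothing (e (punchOut a≢j)) (sym ci≡cj))
  ... | no a≢i | yes _ = ⊥-elim (map-just≢nothing (e (punchOut a≢i)) ci≡cj)
  ... | no a≢i | no a≢j = Step-map id just (e x) (subst₂ (λ i′ j′ → Step (e x) (fun π i′) (fun π j′))
                            (Fin.punchIn-punchOut a≢i) (Fin.punchIn-punchOut a≢j)
                            (Equivalence.to (Step-⇔ (e x) (iso x y) (iso y x)) e-step))
    where
    x = punchOut a≢i
    y = punchOut a≢j
    iso = proj₂ (proj₂ (delete-contained π a))
    e-step : Step (e x) (fun (delete π a) x) (fun (delete π a) y)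
    e-step = steps e-valid tt tt (Equivalence.to (punchOut-<-⇔ a≢i a≢j) i<j)
                               (Sum-map-injective id Maybe.just-injective ci≡cj)

  only-a : ∀ {i} → c i ≡ inj₂ nothing → i ≡ a
  only-a {i} ci≡nothing with a ≟ i
  ... | yes a≡i = sym a≡i
  ... | no a≢i = ⊥-elim (map-just≢nothing (e (punchOut a≢i)) ci≡nothing)

uncoverable-nonempty : {π : Perm n} → ¬ Coverable r s π → Fin n
uncoverable-nonempty {n = zero} uncoverable = ⊥-elim (uncoverable ((λ ()) , (λ ()) , (λ ())))
uncoverable-nonempty {n = suc _} _ = zero

outside-image : (f : Fin k → Fin n) → k ℕ.< n → ∃ λ P → ∀ i → f i ≢ P
outside-image {k} {n} f k<n with Fin.¬∀⟶∃¬ n (λ P → ∃ λ i → f i ≡ P) (λ P → Fin.any? (λ i → f i ≟ P)) not-onto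
  where
  not-onto : ¬ (∀ P → ∃ λ i → f i ≡ P)
  not-onto onto with Fin.pigeonhole k<n (proj₁ ∘ onto)
  ... | P , Q , P<Q , same = ℕₚ.<⇒≢ P<Q (cong toℕ (trans (sym (proj₂ (onto P))) (trans (cong f same) (proj₂ (onto Q)))))
... | P , unhit = P , λ i fi≡P → unhit (i , fi≡P)

merge : Maybe (Fin s₁ ⊎ Fin s₂) → Fin (s₁ + s₂ + 1)
merge {s₁} {s₂} = join (s₁ + s₂) 1 ∘ maybe (inj₁ ∘ join s₁ s₂) (inj₂ zero)

merge-injective : Injective _≡_ _≡_ (merge {s₁} {s₂})
merge-injective {s₁} {s₂} {just x} {just y} e =
  cong just (join-injective s₁ s₂ (inj₁-injective (join-injective (s₁ + s₂) 1 e)))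
merge-injective {s₁} {s₂} {nothing} {nothing} _ = refl
merge-injective {s₁} {s₂} {just x} {nothing} e with join-injective (s₁ + s₂) 1 {inj₁ (join s₁ s₂ x)} {inj₂ zero} e
... | ()
merge-injective {s₁} {s₂} {nothing} {just y} e with join-injective (s₁ + s₂) 1 {inj₂ zero} {inj₁ (join s₁ s₂ y)} e
... | ()

map-inj₁≡map-inj₂ : {x : Maybe I} {y : Maybe D} → Maybe.map inj₁ x ≡ Maybe.map inj₂ y → x ≡ nothing × y ≡ nothing
map-inj₁≡map-inj₂ {x = nothing} {nothing} _ = refl , refl
map-inj₁≡map-inj₂ {x = just _} {just _} ()
map-inj₁≡map-inj₂ {x = just _} {nothing} ()
map-inj₁≡map-inj₂ {x = nothing} {just _} ()

map-≡-inj₂ : {f : I → I′} {g : D → D′} {x : D′} (u : I ⊎ D) → Sum.map f g u ≡ inj₂ x → ∃ λ y → u ≡ inj₂ y × g y ≡ x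
map-≡-inj₂ (inj₂ y) e = y , refl , inj₂-injective e

module _ (π : Perm n) (σ : Perm m) (π-critical : Critical r s₁ π) (σ-critical : Critical r s₂ σ) where

  -- The singleton classes {a} and {b} share one decreasing colour, which is why U must not contain both.
  ⊕-validOn-merged : ∀ {U} (a : Fin n) (b : Fin m) → ¬ (U (a ↑ˡ m) × U (n ↑ʳ b)) →
                     Σ (Fin (n + m) → Fin r ⊎ Fin (s₁ + s₂ + 1)) (ValidOn U (π ⊕ σ))
  ⊕-validOn-merged {U} a b ¬a∧b = c , ⊕-validOn validˡ validʳ crossing
    where
    gˡ : Maybe (Fin s₁) → Fin (s₁ + s₂ + 1)
    gˡ = merge ∘ Maybe.map inj₁
    gʳ : Maybe (Fin s₂) → Fin (s₁ + s₂ + 1)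
    gʳ = merge ∘ Maybe.map inj₂

    cπ = critical-point π-critical a
    cσ = critical-point σ-critical b

    colour : Fin n ⊎ Fin m → Fin r ⊎ Fin (s₁ + s₂ + 1)
    colour = [ Sum.map id gˡ ∘ proj₁ cπ , Sum.map id gʳ ∘ proj₁ cσ ]′

    c : Fin (n + m) → Fin r ⊎ Fin (s₁ + s₂ + 1)
    c = colour ∘ splitAt n

    c-ˡ : ∀ i → Sum.map id gˡ (proj₁ cπ i) ≡ c (i ↑ˡ m)
    c-ˡ i = cong colour (sym (Fin.splitAt-↑ˡ n i m))

    c-ʳ : ∀ j → Sum.map id gʳ (proj₁ cσ j) ≡ c (n ↑ʳ j)
    c-ʳ j = cong colour (sym (Fin.splitAt-↑ʳ n m j))

    validˡ : Valid π (c ∘ (_↑ˡ m))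
    validˡ = validOn-cong c-ˡ
      (validOn-map id (Maybe.map-injective inj₁-injective ∘ merge-injective) (proj₁ (proj₂ cπ)))

    validʳ : Valid σ (c ∘ (n ↑ʳ_))
    validʳ = validOn-cong c-ʳ
      (validOn-map id (Maybe.map-injective inj₂-injective ∘ merge-injective) (proj₁ (proj₂ cσ)))

    crossing : ∀ {i j x} → U (i ↑ˡ m) → U (n ↑ʳ j) → c (i ↑ˡ m) ≡ inj₂ x → c (n ↑ʳ j) ≡ inj₂ x → ⊥
    crossing {i} {j} ui uj ci≡x cj≡x
      with map-≡-inj₂ (proj₁ cπ i) (trans (c-ˡ i) ci≡x) | map-≡-inj₂ (proj₁ cσ j) (trans (c-ʳ j) cj≡x)
    ... | y , cπi≡y , gy≡x | z , cσj≡z , gz≡x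
      with map-inj₁≡map-inj₂ {x = y} {y = z} (merge-injective (trans gy≡x (sym gz≡x)))
    ... | y≡nothing , z≡nothing =
      ¬a∧b (subst (λ i′ → U (i′ ↑ˡ m)) (proj₂ (proj₂ cπ) (trans cπi≡y (cong inj₂ y≡nothing))) ui ,
            subst (λ j′ → U (n ↑ʳ j′)) (proj₂ (proj₂ cσ) (trans cσj≡z (cong inj₂ z≡nothing))) uj)

  ⊕-critical : Critical r (s₁ + s₂ + 1) (π ⊕ σ)
  ⊕-critical = ⊕-uncoverable {π = π} {σ = σ} (proj₁ π-critical) (proj₁ σ-critical) , patterns-coverable
    where
    colouring-avoiding : (P : Fin (n + m)) →
                         Σ (Fin (n + m) → Fin r ⊎ Fin (s₁ + s₂ + 1)) (ValidOn (_≢ P) (π ⊕ σ))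
    colouring-avoiding P with ⊕-view n P
    ... | left a = ⊕-validOn-merged {U = _≢ a ↑ˡ m} a (uncoverable-nonempty {π = σ} (proj₁ σ-critical))
                                    λ { (a≢a , _) → a≢a refl }
    ... | right b = ⊕-validOn-merged {U = _≢ n ↑ʳ b} (uncoverable-nonempty {π = π} (proj₁ π-critical)) b
                                     λ { (_ , b≢b) → b≢b refl }

    patterns-coverable : ∀ k (τ : Perm k) → k ℕ.< n + m → Contains (π ⊕ σ) τ → Coverable r (s₁ + s₂ + 1) τ
    patterns-coverable k τ k<n+m τ⊆ with outside-image (proj₁ τ⊆) k<n+m
    ... | P , unhit = valid⇒coverable {π = τ} (validOn-contains τ⊆ unhit (proj₂ (colouring-avoiding P)))

-- Complements

opposite-injective : Injective _≡_ _≡_ (opposite {n})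
opposite-injective {x = x} {y} e =
  trans (sym (Fin.opposite-involutive x)) (trans (cong opposite e) (Fin.opposite-involutive y))

opposite-<-⇔ : ∀ {x y : Fin n} → x < y ⇔ opposite y < opposite x
opposite-<-⇔ = mk⇔ reverse (λ lt → subst₂ _<_ (Fin.opposite-involutive _) (Fin.opposite-involutive _) (reverse lt))
  where
  reverse : ∀ {x y : Fin n} → x < y → opposite y < opposite x
  reverse {x = x} {y} x<y = subst₂ ℕ._<_ (sym (Fin.opposite-prop y)) (sym (Fin.opposite-prop x))
                                        (ℕₚ.∸-monoʳ-< (s≤s x<y) (Fin.toℕ<n y))

complement : Perm n → Perm n
complement π = perm (opposite ∘ fun π) (inj π ∘ opposite-injective)

Step-swap : {x y : Fin n} (u : I ⊎ D) → Step u (opposite x) (opposite y) → Step (swap u) x y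
Step-swap (inj₁ _) = Equivalence.from opposite-<-⇔
Step-swap (inj₂ _) = Equivalence.from opposite-<-⇔

swap-injective : Injective _≡_ _≡_ (swap {A = I} {B = D})
swap-injective {x = u} {y = v} e = trans (sym (swap-involutive u)) (trans (cong swap e) (swap-involutive v))

complement-valid : {π : Perm n} {c : Fin n → I ⊎ D} → Valid (complement π) c → Valid π (swap ∘ c)
complement-valid {c = c} valid = validOn λ {i} {j} _ _ i<j e →
  Step-swap (c i) (steps valid tt tt i<j (swap-injective e))

complement-contains : {π : Perm n} {τ : Perm k} → Contains (complement π) τ → Contains π (complement τ)
complement-contains (f , f-mono , f-iso) = f , f-mono ,
  λ i j → ⇔.trans (⇔.sym opposite-<-⇔) (⇔.trans (f-iso j i) (⇔.sym opposite-<-⇔))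

critical-complement : (π : Perm n) → Critical r s π → Critical s r (complement π)
critical-complement π (uncoverable , patterns-coverable) =
  (λ cover → uncoverable (valid⇒coverable {π = π} (complement-valid (coverable⇒valid {π = complement π} cover)))) ,
  λ k τ k<n τ⊆ → valid⇒coverable {π = τ} (complement-valid (coverable⇒valid {π = complement τ}
    (patterns-coverable k (complement τ) k<n (complement-contains {π = π} {τ = τ} τ⊆))))

_⊖_ : Perm n → Perm m → Perm (n + m)
π ⊖ σ = complement (complement π ⊕ complement σ)

⊖-critical : ∀ {r₁ r₂} (π : Perm n) (σ : Perm m) → Critical r₁ s π → Critical r₂ s σ →
             Critical (r₁ + r₂ + 1) s (π ⊖ σ)
⊖-critical π σ π-critical σ-critical =
  critical-complement (complement π ⊕ complement σ)
    (⊕-critical (complement π) (complement σ) (critical-complement π π-critical) (critical-complement σ σ-critical))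

singleton : Perm 1
singleton = perm id id

singleton-critical : Critical 0 0 singleton
singleton-critical = (λ { (c , _) → uncolourable (c zero) }) , λ { zero τ _ _ → (λ ()) , (λ ()) , (λ ()) ; (suc _) τ (s≤s ()) _ }
  where
  uncolourable : Fin 0 ⊎ Fin 0 → ⊥
  uncolourable (inj₁ ())
  uncolourable (inj₂ ())

critical-exists-0 : ∀ s → Σ ℕ λ n → Σ (Perm n) (Critical 0 s)
critical-exists-0 zero = 1 , singleton , singleton-critical
critical-exists-0 (suc s) with critical-exists-0 s
... | n , π , π-critical = 1 + n , singleton ⊕ π ,
  subst (λ t → Critical 0 t (singleton ⊕ π)) (ℕₚ.+-comm s 1)
        (⊕-critical singleton π singleton-critical π-critical)

critical-exists : ∀ r s → Σ ℕ λ n → Σ (Perm n) (Critical r s)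
critical-exists zero s = critical-exists-0 s
critical-exists (suc r) s with critical-exists-0 s | critical-exists r s
... | n , π , π-critical | n′ , π′ , π′-critical = n + n′ , π ⊖ π′ ,
  subst (λ t → Critical t s (π ⊖ π′)) (ℕₚ.+-comm r 1) (⊖-critical π π′ π-critical π′-critical)

LeC⇒critical : ∀ {x} → LeC x r s → Σ ℕ λ n → Σ (Perm n) λ π → Critical r s π × x ≤ n
LeC⇒critical (inj₂ x≤C) = x≤C
LeC⇒critical {r = r} {s = s} (inj₁ refl) with critical-exists r s
... | n , π , π-critical = n , π , π-critical , z≤n

LeC-+ : ∀ {r₁ s₁′ r₂ s₂′ x y} (_⊗_ : ∀ {n m} → Perm n → Perm m → Perm (n + m)) →
        (∀ {n m} (π : Perm n) (σ : Perm m) → Critical r₁ s₁′ π → Critical r₂ s₂′ σ → Critical r s (π ⊗ σ)) →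
        LeC x r₁ s₁′ → LeC y r₂ s₂′ → LeC (x + y) r s
LeC-+ _⊗_ ⊗-critical x≤C y≤C with LeC⇒critical x≤C | LeC⇒critical y≤C
... | n , π , π-critical , x≤n | m , σ , σ-critical , y≤m =
  inj₂ (n + m , π ⊗ σ , ⊗-critical π σ π-critical σ-critical , ℕₚ.+-mono-≤ x≤n y≤m)

lemma3 : (∀ r₁ r₂ s x y → LeC x r₁ s → LeC y r₂ s → LeC (x + y) (r₁ + r₂ + 1) s)
       × (∀ r s₁ s₂ x y → LeC x r s₁ → LeC y r s₂ → LeC (x + y) r (s₁ + s₂ + 1))
lemma3 = (λ _ _ _ _ _ → LeC-+ _⊖_ ⊖-critical) , (λ _ _ _ _ _ → LeC-+ _⊕_ ⊕-critical)
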